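{- Let $d\ge 1$ be an integer and, for $t\ge 0$, let $N_t$ be the number of vertices of the $t$-iterated line digraph $L^t(CK(d,4))$ of the cyclic Kautz digraph $CK(d,4)$. Then $$N_t=\alpha\left(\frac{d-1+\sqrt{d^2-2d+5}}{2}\right)^t+\beta\left(\frac{d-1-\sqrt{d^2-2d+5}}{2}\right)^t,$$ where $\alpha=\frac{1}{2}d(d+1)\left(d^2-d+1+\frac{d^3-2d^2+4d-1}{\sqrt{d^2-2d+5}}\right)$ and $\beta=\frac{1}{2}d(d+1)\left(d^2-d+1-\frac{d^3-2d^2+4d-1}{\sqrt{d^2-2d+5}}\right)$. Moreover, if $d=2$, then $N_t=N_{t-1}+N_{t-2}$ for all $t\ge 2$ with $N_0=18$ and $N_1=30$ (a Fibonacci-type sequence with initial values $18,30$).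
   Context: Let $\Sigma$ be an alphabet of $d+1$ distinct symbols. The cyclic Kautz digraph $CK(d,\ell)$ has vertices all words $a_1\ldots a_\ell$ over $\Sigma$ with $a_i\ne a_{i+1}$ for $1\le i\le\ell-1$ and $a_1\ne a_\ell$, and an arc from $a_1a_2\ldots a_\ell$ to $a_2\ldots a_\ell a_{\ell+1}$ whenever both words are vertices. The line digraph $L(G)$ of a digraph $G$ has as vertices the arcs of $G$, with an arc from $(u,v)$ to $(v,w)$ for all arcs $(u,v),(v,w)$ of $G$; $L^0(G)=G$ and $L^t(G)=L(L^{t-1}(G))$. -}

module Defs where

open import Data.Nat as ℕ using (ℕ; zero; suc)
open import Data.Integer as ℤ using (ℤ; +_)
open import Data.Rational as ℚ using (ℚ; 0ℚ; 1ℚ; ½)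
open import Data.Bool using (Bool; true; false; not; _∧_; T)
open import Data.Fin using (Fin)
open import Data.Fin.Properties using () renaming (_≟_ to _≟F_)
open import Data.Vec using (Vec; []; _∷_; init; last)
open import Data.Vec.Properties using (≡-dec)
open import Data.Product using (Σ; _,_; _×_)
open import Relation.Nullary.Decidable using (⌊_⌋)
open import Relation.Binary.PropositionalEquality using (_≡_)

record Digraph : Set₁ where
  field
    V : Set
    A : V → V → Set

open Digraph public

L : Digraph → Digraph
L G = record
  { V = Σ (V G) λ u → Σ (V G) λ v → A G u v
  ; A = λ { (_ , v , _) (v' , _ , _) → v ≡ v' }
  }

L^ : ℕ → Digraph → Digraph
L^ zero    G = G
L^ (suc t) G = L (L^ t G)

module _ {n : ℕ} where
  neqB : Fin n → Fin n → Bool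
  neqB a b = not ⌊ a ≟F b ⌋

  consecB : ∀ {ℓ} → Vec (Fin n) ℓ → Bool
  consecB []           = true
  consecB (a ∷ [])     = true
  consecB (a ∷ b ∷ w)  = neqB a b ∧ consecB (b ∷ w)

  cyclicB : ∀ {ℓ} → Vec (Fin n) ℓ → Bool
  cyclicB []      = true
  cyclicB (a ∷ w) = neqB a (last (a ∷ w))

  isCKWord : ∀ {ℓ} → Vec (Fin n) ℓ → Bool
  isCKWord w = consecB w ∧ cyclicB w

  arcB : ∀ {ℓ} → Vec (Fin n) ℓ → Vec (Fin n) ℓ → Bool
  arcB []      []      = true
  arcB (a ∷ x) (b ∷ y) = ⌊ ≡-dec _≟F_ x (init (b ∷ y)) ⌋

CK : (d ℓ : ℕ) → Digraph
CK d ℓ = record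
  { V = Σ (Vec (Fin (suc d)) ℓ) λ w → T (isCKWord w)
  ; A = λ x y → T (arcB (Data.Product.proj₁ x) (Data.Product.proj₁ y))
  }

-- The ring ℚ[√D] = { a + b √D : a b ∈ ℚ } (formal square root of D)

record ℚ√ : Set where
  constructor ⟨_,_⟩
  field
    re : ℚ
    im : ℚ
open ℚ√ public

module _ (D : ℚ) where
  _+√_ : ℚ√ → ℚ√ → ℚ√
  ⟨ a , b ⟩ +√ ⟨ c , e ⟩ = ⟨ a ℚ.+ c , b ℚ.+ e ⟩

  _*√_ : ℚ√ → ℚ√ → ℚ√
  ⟨ a , b ⟩ *√ ⟨ c , e ⟩ = ⟨ a ℚ.* c ℚ.+ D ℚ.* (b ℚ.* e) , a ℚ.* e ℚ.+ b ℚ.* c ⟩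

  _^√_ : ℚ√ → ℕ → ℚ√
  x ^√ zero  = ⟨ 1ℚ , 0ℚ ⟩
  x ^√ suc t = x *√ (x ^√ t)

-- D = d² - 2d + 5 = (d - 1)² + 4   (for d ≥ 1), as a natural number
Dℕ : ℕ → ℕ
Dℕ d = 4 ℕ.+ (d ℕ.∸ 1) ℕ.* (d ℕ.∸ 1)

Dℚ : ℕ → ℚ
Dℚ d = + Dℕ d ℚ./ 1

ℤtoℚ : ℤ → ℚ
ℤtoℚ z = z ℚ./ 1

λ₊ λ₋ : ℕ → ℚ√
λ₊ d = ⟨ ℤtoℚ (+ d ℤ.- + 1) ℚ.* ½ , ½ ⟩
λ₋ d = ⟨ ℤtoℚ (+ d ℤ.- + 1) ℚ.* ½ , ℚ.- ½ ⟩

Aℤ Bℤ : ℕ → ℤ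
Aℤ d = + d ℤ.* + d ℤ.- + d ℤ.+ + 1
Bℤ d = + d ℤ.* + d ℤ.* + d ℤ.- + 2 ℤ.* + d ℤ.* + d ℤ.+ + 4 ℤ.* + d ℤ.- + 1

cℚ : ℕ → ℚ
cℚ d = ½ ℚ.* ℤtoℚ (+ d ℤ.* + (suc d))

-- α = ½ d(d+1) (A + B/√D) = ½ d(d+1) (A + (B/D) √D), β likewise with −.
α β : ℕ → ℚ√
α d = ⟨ cℚ d ℚ.* ℤtoℚ (Aℤ d) , cℚ d ℚ.* (Bℤ d ℚ./ Dℕ d) ⟩
β d = ⟨ cℚ d ℚ.* ℤtoℚ (Aℤ d) , ℚ.- (cℚ d ℚ.* (Bℤ d ℚ./ Dℕ d)) ⟩

closedForm : ℕ → ℕ → ℚ√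
closedForm d t =
  _+√_ (Dℚ d) (_*√_ (Dℚ d) (α d) (_^√_ (Dℚ d) (λ₊ d) t))
              (_*√_ (Dℚ d) (β d) (_^√_ (Dℚ d) (λ₋ d) t))

ℕtoℚ√ : ℕ → ℚ√
ℕtoℚ√ n = ⟨ + n ℚ./ 1 , 0ℚ ⟩

-- Colour a vertex abce of CK(d,4) by whether b = e. A vertex of Lᵗ(G) is a walk of
-- length t in G, and the successors of abce are the words bcez with z ∉ {b, e}; the
-- colour of bcez is whether z = c. Hence every vertex has exactly one successor of
-- colour "b = e", and d − 1 (if b = e) or d − 2 (if b ≠ e) successors of the other
-- colour. Counting walks by the colour of their last vertex therefore follows the
-- transfer matrix [[1, d − 1], [1, d − 2]], of trace d − 1 and determinant −1, so
-- N (t + 2) = (d − 1) N (t + 1) + N t. The roots (d − 1 ± √(d² − 2d + 5)) / 2 of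
-- x² = (d − 1) x + 1 make the closed form satisfy the same recurrence in ℚ[√D], and
-- both agree at t = 0 and t = 1, where N₀ = d(d+1)(d² − d + 1) and
-- N₁ = d(d+1)(d³ − 2d² + 3d − 1).

module Submission where

open import Defs
open import Axiom.UniquenessOfIdentityProofs using (module Decidable⇒UIP)
open import Data.Bool using (Bool; true; false; _∧_; T)
open import Data.Bool.Properties using (T-∧; T-≡; T-not-≡; T-irrelevant; ∧-assoc; ∧-idem) renaming (_≟_ to _≟ᵇ_)
open import Data.Empty using (⊥-elim)
open import Data.Fin using (Fin; zero; punchIn; punchOut; #_)
open import Data.Fin.Properties
  using (_≟_; punchOut-cong; punchOut-punchIn; punchIn-punchOut; punchInᵢ≢i; punchOut-injective; *↔×; +↔⊎)
open import Data.Integer as ℤ using (ℤ; +_)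
import Data.Integer.Properties as ℤ
open import Data.Integer.Tactic.RingSolver as ℤ-Solver using ()
open import Data.Nat using (ℕ; zero; suc; _≤_; _+_; _*_; _∸_)
import Data.Nat.Properties as ℕ
open import Data.Nat.Coprimality using (1-coprimeTo) renaming (sym to coprime-sym)
open import Data.Nat.Tactic.RingSolver as ℕ-Solver using ()
open import Data.Product using (Σ; _,_; _×_; proj₁; proj₂)
open import Data.Product.Function.Dependent.Propositional using (congˡ)
open import Data.Product.Function.NonDependent.Propositional using (_×-↔_)
open import Data.Rational as ℚ using (ℚ; mkℚ; 0ℚ; 1ℚ; ½; toℚᵘ)
open import Data.Rational.Properties using (↥p/↧p≡p; /-cong; toℚᵘ-injective; toℚᵘ-homo-*; toℚᵘ-fromℚᵘ)
open import Data.Rational.Solver using (module +-*-Solver)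
import Data.Rational.Unnormalised as ℚᵘ
import Data.Rational.Unnormalised.Properties as ℚᵘ
open import Data.Sum using (_⊎_; inj₁; inj₂)
open import Data.Sum.Function.Propositional using (_⊎-↔_)
open import Data.Unit using (tt)
open import Data.Unit.Polymorphic using (⊤)
open import Data.Vec using (Vec; []; _∷_)
open import Data.Vec.Properties using (≡-dec)
open import Data.Vec.Relation.Unary.All as All using (All; []; _∷_)
open import Data.Vec.Relation.Unary.AllPairs using ([]; _∷_)
open import Data.Vec.Relation.Unary.Unique.Propositional using (Unique)
open import Function using (_∘_)
open import Function.Bundles using (_↔_; _⇔_; mk↔ₛ′; mk⇔; Equivalence)
open import Function.Properties.Inverse using (↔-refl; ↔-sym; ↔-trans)
open import Function.Related.TypeIsomorphisms using (Σ-assoc; ×-identityʳ; ×-identityˡ; ×-distribʳ-⊎; Σ-distribˡ-⊎)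
open import Level using (0ℓ)
open import Relation.Binary.PropositionalEquality
open import Relation.Nullary using (Dec; Irrelevant; ¬_; yes; no; contradiction)
open import Relation.Nullary.Decidable using (⌊_⌋; toWitness; fromWitness; toWitnessFalse; fromWitnessFalse)

open +-*-Solver using (Polynomial; con; var; _:+_; _:*_; :-_; prove; solve; _:=_)

infixr 2 _⟨↔⟩_
_⟨↔⟩_ : {A B C : Set} → A ↔ B → B ↔ C → A ↔ C
_⟨↔⟩_ = ↔-trans

T-cong-↔ : {x y : Bool} → x ≡ y → T x ↔ T y
T-cong-↔ refl = ↔-refl

Bool-≡-irrelevant : {b c : Bool} → Irrelevant (b ≡ c)
Bool-≡-irrelevant = Decidable⇒UIP.≡-irrelevant _≟ᵇ_

Σ-≡-irrelevant : {A : Set} {P : A → Set} → (∀ x → Irrelevant (P x)) →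
                 ∀ {x y} {p : P x} {q : P y} → x ≡ y → (x , p) ≡ (y , q)
Σ-≡-irrelevant P-irr refl = cong (_ ,_) (P-irr _ _ _)

Σ-cong-⇔ : {A : Set} {P Q : A → Set} → (∀ x → Irrelevant (P x)) → (∀ x → Irrelevant (Q x)) →
           (∀ x → P x ⇔ Q x) → Σ A P ↔ Σ A Q
Σ-cong-⇔ P-irr Q-irr P⇔Q = mk↔ₛ′
  (λ (x , p) → x , Equivalence.to (P⇔Q x) p) (λ (x , q) → x , Equivalence.from (P⇔Q x) q)
  (λ _ → Σ-≡-irrelevant Q-irr refl) (λ _ → Σ-≡-irrelevant P-irr refl)

Σ-Fin-* : {A : Set} {B : A → Set} {k m : ℕ} → A ↔ Fin k → (∀ x → B x ↔ Fin m) → Σ A B ↔ Fin (k * m)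
Σ-Fin-* A↔k B↔m = congˡ (B↔m _) ⟨↔⟩ (A↔k ×-↔ ↔-refl) ⟨↔⟩ ↔-sym *↔×

squared : {X : Set} {k : ℕ} → X ↔ Fin k → (X × X) ↔ Fin (k * k)
squared X↔k = Σ-Fin-* X↔k (λ _ → X↔k)

Bool-cases : (b : Bool) → ⊤ {0ℓ} ↔ (b ≡ true ⊎ b ≡ false)
Bool-cases true  = mk↔ₛ′ (λ _ → inj₁ refl) _ (λ { (inj₁ refl) → refl ; (inj₂ ()) }) (λ _ → refl)
Bool-cases false = mk↔ₛ′ (λ _ → inj₂ refl) _ (λ { (inj₁ ()) ; (inj₂ refl) → refl }) (λ _ → refl)

Σ-partition : {A : Set} (f : A → Bool) (B : A → Set) →
              Σ A B ↔ (Σ A (λ x → f x ≡ true × B x) ⊎ Σ A (λ x → f x ≡ false × B x))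
Σ-partition f _ =
  congˡ (↔-sym (×-identityˡ _ _) ⟨↔⟩ (Bool-cases (f _) ×-↔ ↔-refl) ⟨↔⟩ ×-distribʳ-⊎) ⟨↔⟩ Σ-distribˡ-⊎

⌊⌋≡true⇔ : {P : Set} {p? : Dec P} → ⌊ p? ⌋ ≡ true ⇔ P
⌊⌋≡true⇔ = mk⇔ (toWitness ∘ Equivalence.from T-≡) (Equivalence.to T-≡ ∘ fromWitness)

⌊⌋≡false⇔ : {P : Set} {p? : Dec P} → ⌊ p? ⌋ ≡ false ⇔ (¬ P)
⌊⌋≡false⇔ = mk⇔ (toWitnessFalse ∘ Equivalence.from T-not-≡) (Equivalence.to T-not-≡ ∘ fromWitnessFalse)

singleton-↔ : ∀ {n} (a : Fin n) → Σ (Fin n) (λ z → ⌊ a ≟ z ⌋ ≡ true) ↔ Fin 1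
singleton-↔ a = mk↔ₛ′ (λ _ → zero) (λ _ → a , Equivalence.from ⌊⌋≡true⇔ refl) (λ { zero → refl })
  (λ (_ , a≡z) → Σ-≡-irrelevant (λ _ → Bool-≡-irrelevant) (Equivalence.to ⌊⌋≡true⇔ a≡z))

avoids : ∀ {n k} → Vec (Fin n) k → Fin n → Bool
avoids []       _ = true
avoids (a ∷ as) z = neqB a z ∧ avoids as z

avoids⇔ : ∀ {n k} (as : Vec (Fin n) k) {z} → T (avoids as z) ⇔ All (_≢ z) as
avoids⇔ []       = mk⇔ (λ _ → []) (λ _ → tt)
avoids⇔ (a ∷ as) = mk⇔
  (λ t → let (p , q) = Equivalence.to T-∧ t in toWitnessFalse p ∷ Equivalence.to (avoids⇔ as) q)
  (λ { (a≢z ∷ as≢z) → Equivalence.from T-∧ (fromWitnessFalse a≢z , Equivalence.from (avoids⇔ as) as≢z) })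

avoids-dup : ∀ {n k} (a : Fin n) (as : Vec (Fin n) k) z → avoids (a ∷ a ∷ as) z ≡ avoids (a ∷ as) z
avoids-dup a as z = trans (sym (∧-assoc (neqB a z) _ _)) (cong (_∧ avoids as z) (∧-idem (neqB a z)))

Σ-punchIn : ∀ {n} (a : Fin (suc n)) (h : Fin (suc n) → Bool) →
            Σ (Fin (suc n)) (λ z → T (neqB a z ∧ h z)) ↔ Σ (Fin n) (λ y → T (h (punchIn a y)))
Σ-punchIn {n} a h = mk↔ₛ′ to from to∘from from∘to
  where
  to : Σ (Fin (suc n)) (λ z → T (neqB a z ∧ h z)) → Σ (Fin n) (λ y → T (h (punchIn a y)))
  to (z , p) = let (a≢z , hz) = Equivalence.to T-∧ p in
    punchOut (toWitnessFalse a≢z) , subst (T ∘ h) (sym (punchIn-punchOut (toWitnessFalse a≢z))) hz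
  from : Σ (Fin n) (λ y → T (h (punchIn a y))) → Σ (Fin (suc n)) (λ z → T (neqB a z ∧ h z))
  from (y , hy) = punchIn a y , Equivalence.from T-∧ (fromWitnessFalse (punchInᵢ≢i a y ∘ sym) , hy)
  to∘from : ∀ w → to (from w) ≡ w
  to∘from _ = Σ-≡-irrelevant (λ _ → T-irrelevant) (trans (punchOut-cong a refl) (punchOut-punchIn a))
  from∘to : ∀ w → from (to w) ≡ w
  from∘to _ = Σ-≡-irrelevant (λ _ → T-irrelevant) (punchIn-punchOut _)

neqB-punchIn : ∀ {n} {a b : Fin (suc n)} (a≢b : a ≢ b) (y : Fin n) →
               neqB b (punchIn a y) ≡ neqB (punchOut a≢b) y
neqB-punchIn {a = a} {b} a≢b y with b ≟ punchIn a y | punchOut a≢b ≟ y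
... | yes _    | yes _    = refl
... | no  _    | no  _    = refl
... | yes refl | no  ≢y   = contradiction (trans (punchOut-cong a refl) (punchOut-punchIn a)) ≢y
... | no  b≢   | yes refl = contradiction (sym (punchIn-punchOut a≢b)) b≢

punchOuts : ∀ {n k} {a : Fin (suc n)} (bs : Vec (Fin (suc n)) k) → All (a ≢_) bs → Vec (Fin n) k
punchOuts []       []           = []
punchOuts (b ∷ bs) (a≢b ∷ a≢bs) = punchOut a≢b ∷ punchOuts bs a≢bs

avoids-punchIn : ∀ {n k} {a : Fin (suc n)} (bs : Vec (Fin (suc n)) k) (a≢bs : All (a ≢_) bs) (y : Fin n) →
                 avoids bs (punchIn a y) ≡ avoids (punchOuts bs a≢bs) y
avoids-punchIn []       []           y = refl
avoids-punchIn (b ∷ bs) (a≢b ∷ a≢bs) y = cong₂ _∧_ (neqB-punchIn a≢b y) (avoids-punchIn bs a≢bs y)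

punchOuts-unique : ∀ {n k} {a : Fin (suc n)} (bs : Vec (Fin (suc n)) k) (a≢bs : All (a ≢_) bs) →
                   Unique bs → Unique (punchOuts bs a≢bs)
punchOuts-unique []       []           []           = []
punchOuts-unique (b ∷ bs) (a≢b ∷ a≢bs) (b∉bs ∷ !bs) = distinct bs a≢bs b∉bs ∷ punchOuts-unique bs a≢bs !bs
  where
  distinct : ∀ {k} (cs : Vec _ k) (a≢cs : All (_ ≢_) cs) → All (b ≢_) cs →
             All (punchOut a≢b ≢_) (punchOuts cs a≢cs)
  distinct []       []           []           = []
  distinct (c ∷ cs) (a≢c ∷ a≢cs) (b≢c ∷ b≢cs) = b≢c ∘ punchOut-injective a≢b a≢c ∷ distinct cs a≢cs b≢cs

avoiding-↔ : ∀ {n k} (as : Vec (Fin n) k) → Unique as → Σ (Fin n) (T ∘ avoids as) ↔ Fin (n ∸ k)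
avoiding-↔ []       [] = mk↔ₛ′ proj₁ (_, _) (λ _ → refl) (λ _ → refl)
avoiding-↔ {zero}  (() ∷ _)  _
avoiding-↔ {suc n} (a ∷ as) (a∉as ∷ !as) =
  Σ-punchIn a (avoids as) ⟨↔⟩
  congˡ (T-cong-↔ (avoids-punchIn as a∉as _)) ⟨↔⟩
  avoiding-↔ (punchOuts as a∉as) (punchOuts-unique as a∉as !as)

-- Iterated line digraphs

Out : (G : Digraph) → V G → Set
Out G u = Σ (V G) (A G u)

terminal : (G : Digraph) (t : ℕ) → V (L^ t G) → V G
terminal G zero    x           = x
terminal G (suc t) (_ , v , _) = terminal G t v

Out-L : (H : Digraph) {u v : V H} (e : A H u v) (P : V H → Set) →
        Σ (Out (L H) (u , v , e)) (P ∘ proj₁ ∘ proj₂ ∘ proj₁) ↔ Σ (Out H v) (P ∘ proj₁)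
Out-L H {v = v} e P = mk↔ₛ′ to from (λ _ → refl) from∘to
  where
  to : Σ (Out (L H) (_ , v , e)) (P ∘ proj₁ ∘ proj₂ ∘ proj₁) → Σ (Out H v) (P ∘ proj₁)
  to (((_ , w , e′) , refl) , p) = (w , e′) , p
  from : Σ (Out H v) (P ∘ proj₁) → Σ (Out (L H) (_ , v , e)) (P ∘ proj₁ ∘ proj₂ ∘ proj₁)
  from ((w , e′) , p) = ((v , w , e′) , refl) , p
  from∘to : ∀ x → from (to x) ≡ x
  from∘to (((_ , _ , _) , refl) , _) = refl

Out-L^ : (G : Digraph) (t : ℕ) (x : V (L^ t G)) (P : V G → Set) →
         Σ (Out (L^ t G) x) (P ∘ terminal G t ∘ proj₁) ↔ Σ (Out G (terminal G t x)) (P ∘ proj₁)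
Out-L^ G zero    x           P = ↔-refl
Out-L^ G (suc t) (_ , v , e) P = Out-L (L^ t G) e (P ∘ terminal G t) ⟨↔⟩ Out-L^ G t v P

module TwoColourTransfer
  (G : Digraph) (colour : V G → Bool) (n₀ : Bool → ℕ) (m : Bool → Bool → ℕ)
  (base : ∀ c → Σ (V G) (λ v → colour v ≡ c) ↔ Fin (n₀ c))
  (fibre : ∀ v c → Σ (Out G v) (λ o → colour (proj₁ o) ≡ c) ↔ Fin (m (colour v) c))
  where

  walks : ℕ → Bool → ℕ
  walks zero    c = n₀ c
  walks (suc t) c = walks t true * m true c + walks t false * m false c

  ColourClass : ℕ → Bool → Set
  ColourClass t c = Σ (V (L^ t G)) (λ x → colour (terminal G t x) ≡ c)

  colourClass-↔ : ∀ t c → ColourClass t c ↔ Fin (walks t c)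
  colourClass-↔ zero    c = base c
  colourClass-↔ (suc t) c =
    Σ-assoc {C = λ _ o → colour (terminal G t (proj₁ o)) ≡ c} ⟨↔⟩
    congˡ (Out-L^ G t _ (λ w → colour w ≡ c)) ⟨↔⟩
    Σ-partition (colour ∘ terminal G t) _ ⟨↔⟩
    (predecessors true ⊎-↔ predecessors false) ⟨↔⟩
    ↔-sym +↔⊎
    where
    predecessors : ∀ b →
      Σ (V (L^ t G)) (λ x → colour (terminal G t x) ≡ b
                          × Σ (Out G (terminal G t x)) (λ o → colour (proj₁ o) ≡ c))
      ↔ Fin (walks t b * m b c)
    predecessors b = ↔-sym Σ-assoc ⟨↔⟩ Σ-Fin-* (colourClass-↔ t b)
      (λ (x , x∈b) → subst (λ b′ → _ ↔ Fin (m b′ c)) x∈b (fibre (terminal G t x) c))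

  vertices-↔ : ∀ t → V (L^ t G) ↔ Fin (walks t true + walks t false)
  vertices-↔ t =
    ↔-sym (×-identityʳ _ _) ⟨↔⟩ Σ-partition (colour ∘ terminal G t) (λ _ → ⊤) ⟨↔⟩
    (colourClass true ⊎-↔ colourClass false) ⟨↔⟩ ↔-sym +↔⊎
    where
    colourClass : ∀ c → Σ (V (L^ t G)) (λ x → colour (terminal G t x) ≡ c × ⊤) ↔ Fin (walks t c)
    colourClass c = congˡ (×-identityʳ _ _) ⟨↔⟩ colourClass-↔ t c

-- The cyclic Kautz digraph CK(d, 4)

module CK4 (d : ℕ) where

  Ω : Set
  Ω = Fin (suc d)

  CK4-word⇔ : (a b c e : Ω) → T (isCKWord (a ∷ b ∷ c ∷ e ∷ [])) ⇔ (a ≢ b × b ≢ c × c ≢ e × a ≢ e)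
  CK4-word⇔ a b c e = mk⇔ to from
    where
    to : T (isCKWord (a ∷ b ∷ c ∷ e ∷ [])) → a ≢ b × b ≢ c × c ≢ e × a ≢ e
    to ok with a ≟ b | b ≟ c | c ≟ e | a ≟ e
    ... | no a≢b | no b≢c | no c≢e | no a≢e = a≢b , b≢c , c≢e , a≢e
    ... | yes _  | _      | _      | _      = ⊥-elim ok
    ... | no _   | yes _  | _      | _      = ⊥-elim ok
    ... | no _   | no _   | yes _  | _      = ⊥-elim ok
    ... | no _   | no _   | no _   | yes _  = ⊥-elim ok
    from : a ≢ b × b ≢ c × c ≢ e × a ≢ e → T (isCKWord (a ∷ b ∷ c ∷ e ∷ []))
    from (a≢b , b≢c , c≢e , a≢e) with a ≟ b | b ≟ c | c ≟ e | a ≟ e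
    ... | no _    | no _    | no _    | no _    = tt
    ... | yes a≡b | _       | _       | _       = a≢b a≡b
    ... | no _    | yes b≡c | _       | _       = b≢c b≡c
    ... | no _    | no _    | yes c≡e | _       = c≢e c≡e
    ... | no _    | no _    | no _    | yes a≡e = a≢e a≡e

  Out-CK4 : ∀ {a b c e} (ok : T (isCKWord (a ∷ b ∷ c ∷ e ∷ []))) (P : V (CK d 4) → Set) →
            Σ (Out (CK d 4) ((a ∷ b ∷ c ∷ e ∷ []) , ok)) (P ∘ proj₁)
            ↔ Σ Ω (λ z → Σ (T (isCKWord (b ∷ c ∷ e ∷ z ∷ []))) (λ ok′ → P ((b ∷ c ∷ e ∷ z ∷ []) , ok′)))
  Out-CK4 {a} {b} {c} {e} ok P = mk↔ₛ′ to from to∘from from∘to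
    where
    Successor : Set
    Successor = Σ Ω (λ z → Σ (T (isCKWord (b ∷ c ∷ e ∷ z ∷ []))) (λ ok′ → P ((b ∷ c ∷ e ∷ z ∷ []) , ok′)))
    to : Σ (Out (CK d 4) ((a ∷ b ∷ c ∷ e ∷ []) , ok)) (P ∘ proj₁) → Successor
    to ((((_ ∷ _ ∷ _ ∷ z ∷ []) , ok′) , arc) , p) with toWitness arc
    ... | refl = z , ok′ , p
    from : Successor → Σ (Out (CK d 4) ((a ∷ b ∷ c ∷ e ∷ []) , ok)) (P ∘ proj₁)
    from (z , ok′ , p) = (((b ∷ c ∷ e ∷ z ∷ []) , ok′) , fromWitness refl) , p
    to∘from : ∀ y → to (from y) ≡ y
    to∘from (z , ok′ , p) with toWitness (fromWitness {a? = ≡-dec _≟_ (b ∷ c ∷ e ∷ []) (b ∷ c ∷ e ∷ [])} refl)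
    ... | refl = refl
    from∘to : ∀ x → from (to x) ≡ x
    from∘to ((((_ ∷ _ ∷ _ ∷ z ∷ []) , ok′) , arc) , p) with toWitness arc
    ... | refl = cong (λ arc′ → (((b ∷ c ∷ e ∷ z ∷ []) , ok′) , arc′) , p) (T-irrelevant _ _)

  colour : V (CK d 4) → Bool
  colour ((_ ∷ b ∷ _ ∷ e ∷ []) , _) = ⌊ b ≟ e ⌋

  successors : Bool → Bool → ℕ
  successors _     true  = 1
  successors true  false = d ∸ 1
  successors false false = d ∸ 2

  fibre : ∀ v c′ → Σ (Out (CK d 4) v) (λ o → colour (proj₁ o) ≡ c′) ↔ Fin (successors (colour v) c′)
  fibre ((a ∷ b ∷ c ∷ e ∷ []) , ok) c′ = Out-CK4 ok (λ o → colour o ≡ c′) ⟨↔⟩ count c′ (b ≟ e)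
    where
    b≢c : b ≢ c
    b≢c = proj₁ (proj₂ (Equivalence.to (CK4-word⇔ a b c e) ok))
    c≢e : c ≢ e
    c≢e = proj₁ (proj₂ (proj₂ (Equivalence.to (CK4-word⇔ a b c e) ok)))

    Next : Bool → Ω → Set
    Next c′ z = T (isCKWord (b ∷ c ∷ e ∷ z ∷ [])) × ⌊ c ≟ z ⌋ ≡ c′

    Next-irrelevant : ∀ c′ z → Irrelevant (Next c′ z)
    Next-irrelevant c′ z (p , q) (p′ , q′) = cong₂ _,_ (T-irrelevant p p′) (Bool-≡-irrelevant q q′)

    Next↔Avoiding : ∀ c′ {k} (as : Vec Ω k) → (∀ z → Next c′ z ⇔ All (_≢ z) as) →
                    Σ Ω (Next c′) ↔ Σ Ω (T ∘ avoids as)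
    Next↔Avoiding c′ as Next⇔ = Σ-cong-⇔ (Next-irrelevant c′) (λ _ → T-irrelevant)
      (λ z → mk⇔ (Equivalence.from (avoids⇔ as) ∘ Equivalence.to (Next⇔ z))
                 (Equivalence.from (Next⇔ z) ∘ Equivalence.to (avoids⇔ as)))

    count : ∀ c′ (b≟e : Dec (b ≡ e)) → Σ Ω (Next c′) ↔ Fin (successors ⌊ b≟e ⌋ c′)
    count true _ =
      Σ-cong-⇔ (Next-irrelevant true) (λ _ → Bool-≡-irrelevant)
        (λ z → mk⇔ proj₂ (λ c≡z → word (Equivalence.to ⌊⌋≡true⇔ c≡z) , c≡z)) ⟨↔⟩
      singleton-↔ c
      where
      word : ∀ {z} → c ≡ z → T (isCKWord (b ∷ c ∷ e ∷ z ∷ []))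
      word refl = Equivalence.from (CK4-word⇔ b c e c) (b≢c , c≢e , c≢e ∘ sym , b≢c)
    count false (yes b≡e) =
      Next↔Avoiding false (c ∷ e ∷ []) (λ z → mk⇔
        (λ (ok′ , c≠z) → Equivalence.to ⌊⌋≡false⇔ c≠z ∷ proj₁ (proj₂ (proj₂ (Equivalence.to (CK4-word⇔ b c e _) ok′))) ∷ [])
        (λ { (c≢z ∷ e≢z ∷ []) → Equivalence.from (CK4-word⇔ b c e _) (b≢c , c≢e , e≢z , e≢z ∘ trans (sym b≡e))
                              , Equivalence.from ⌊⌋≡false⇔ c≢z })) ⟨↔⟩
      avoiding-↔ (c ∷ e ∷ []) ((c≢e ∷ []) ∷ [] ∷ [])
    count false (no b≢e) =
      Next↔Avoiding false (c ∷ e ∷ b ∷ []) (λ z → mk⇔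
        (λ (ok′ , c≠z) → let (_ , _ , e≢z , b≢z) = Equivalence.to (CK4-word⇔ b c e _) ok′ in
                         Equivalence.to ⌊⌋≡false⇔ c≠z ∷ e≢z ∷ b≢z ∷ [])
        (λ { (c≢z ∷ e≢z ∷ b≢z ∷ []) → Equivalence.from (CK4-word⇔ b c e _) (b≢c , c≢e , e≢z , b≢z)
                                    , Equivalence.from ⌊⌋≡false⇔ c≢z })) ⟨↔⟩
      avoiding-↔ (c ∷ e ∷ b ∷ []) ((c≢e ∷ b≢c ∘ sym ∷ []) ∷ (b≢e ∘ sym ∷ []) ∷ [] ∷ [])

  Avoiding : ∀ {k} → Vec Ω k → Set
  Avoiding as = Σ Ω (T ∘ avoids as)

  -- abce is a cyclic Kautz word exactly when both a and c avoid {b, e}.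
  Middle : Bool → Set
  Middle c′ = Σ Ω (λ b → Σ (Σ Ω (λ e → ⌊ b ≟ e ⌋ ≡ c′)) (λ (e , _) → Avoiding (b ∷ e ∷ []) × Avoiding (b ∷ e ∷ [])))

  colourClass↔Middle : ∀ c′ → Σ (V (CK d 4)) (λ v → colour v ≡ c′) ↔ Middle c′
  colourClass↔Middle c′ = mk↔ₛ′ to from to∘from from∘to
    where
    to : Σ (V (CK d 4)) (λ v → colour v ≡ c′) → Middle c′
    to (((a ∷ b ∷ c ∷ e ∷ []) , ok) , b≟e) =
      let (a≢b , b≢c , c≢e , a≢e) = Equivalence.to (CK4-word⇔ a b c e) ok in
      b , (e , b≟e) , (a , Equivalence.from (avoids⇔ _) (a≢b ∘ sym ∷ a≢e ∘ sym ∷ []))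
                    , (c , Equivalence.from (avoids⇔ _) (b≢c ∷ c≢e ∘ sym ∷ []))
    from : Middle c′ → Σ (V (CK d 4)) (λ v → colour v ≡ c′)
    from (b , (e , b≟e) , (a , a∉be) , (c , c∉be))
      with Equivalence.to (avoids⇔ (b ∷ e ∷ [])) a∉be | Equivalence.to (avoids⇔ (b ∷ e ∷ [])) c∉be
    ... | b≢a ∷ e≢a ∷ [] | b≢c ∷ e≢c ∷ [] =
      ((a ∷ b ∷ c ∷ e ∷ []) , Equivalence.from (CK4-word⇔ a b c e) (b≢a ∘ sym , b≢c , e≢c ∘ sym , e≢a ∘ sym)) , b≟e
    to∘from : ∀ y → to (from y) ≡ y
    to∘from (b , (e , b≟e) , (a , a∉be) , (c , c∉be))
      with Equivalence.to (avoids⇔ (b ∷ e ∷ [])) a∉be | Equivalence.to (avoids⇔ (b ∷ e ∷ [])) c∉be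
    ... | _ ∷ _ ∷ [] | _ ∷ _ ∷ [] =
      cong₂ (λ p q → b , (e , b≟e) , (a , p) , (c , q)) (T-irrelevant _ _) (T-irrelevant _ _)
    from∘to : ∀ x → from (to x) ≡ x
    from∘to (((a ∷ b ∷ c ∷ e ∷ []) , ok) , b≟e) =
      cong (λ ok′ → ((a ∷ b ∷ c ∷ e ∷ []) , ok′) , b≟e) (T-irrelevant _ _)

  initial : Bool → ℕ
  initial true  = suc d * (1 * (d * d))
  initial false = suc d * (d * ((d ∸ 1) * (d ∸ 1)))

  Middle-↔ : ∀ c′ → Middle c′ ↔ Fin (initial c′)
  Middle-↔ true  = Σ-Fin-* ↔-refl λ b →
    Σ-Fin-* (singleton-↔ b) λ (e , b≡e) → squared (avoidingTwice (Equivalence.to ⌊⌋≡true⇔ b≡e))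
    where
    avoidingTwice : ∀ {b e} → b ≡ e → Avoiding (b ∷ e ∷ []) ↔ Fin d
    avoidingTwice {b} refl = congˡ (T-cong-↔ (avoids-dup b [] _)) ⟨↔⟩ avoiding-↔ (b ∷ []) ([] ∷ [])
  Middle-↔ false = Σ-Fin-* ↔-refl λ b →
    Σ-Fin-* (different b) λ (e , b≢e) →
      squared (avoiding-↔ (b ∷ e ∷ []) ((Equivalence.to ⌊⌋≡false⇔ b≢e ∷ []) ∷ [] ∷ []))
    where
    different : ∀ b → Σ Ω (λ e → ⌊ b ≟ e ⌋ ≡ false) ↔ Fin d
    different b = Σ-cong-⇔ (λ _ → Bool-≡-irrelevant) (λ _ → T-irrelevant)
      (λ e → mk⇔ (λ b≢e → Equivalence.from (avoids⇔ (b ∷ [])) (Equivalence.to ⌊⌋≡false⇔ b≢e ∷ []))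
                 (λ t → Equivalence.from ⌊⌋≡false⇔ (All.head (Equivalence.to (avoids⇔ (b ∷ [])) t)))) ⟨↔⟩
      avoiding-↔ (b ∷ []) ([] ∷ [])

  module Transfer = TwoColourTransfer (CK d 4) colour initial successors
    (λ c′ → colourClass↔Middle c′ ⟨↔⟩ Middle-↔ c′) fibre

ι : ℕ → ℚ
ι n = + n ℚ./ 1

ι≡mkℚ : ∀ n → ι n ≡ mkℚ (+ n) 0 (coprime-sym (1-coprimeTo n))
ι≡mkℚ n = ↥p/↧p≡p _

ι-+ : ∀ m n → ι (m + n) ≡ ι m ℚ.+ ι n
ι-+ m n = sym (trans (cong₂ ℚ._+_ (ι≡mkℚ m) (ι≡mkℚ n))
                     (/-cong (cong₂ ℤ._+_ (ℤ.*-identityʳ (+ m)) (ℤ.*-identityʳ (+ n))) refl))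

ι-* : ∀ m n → ι (m * n) ≡ ι m ℚ.* ι n
ι-* m n = sym (trans (cong₂ ℚ._*_ (ι≡mkℚ m) (ι≡mkℚ n)) (/-cong (sym (ℤ.pos-* m n)) refl))

ι-*-/ : ∀ k (z : ℤ) → ι (suc k) ℚ.* (z ℚ./ suc k) ≡ z ℚ./ 1
ι-*-/ k z = toℚᵘ-injective (begin
  toℚᵘ (ι (suc k) ℚ.* (z ℚ./ suc k))       ≈⟨ toℚᵘ-homo-* (ι (suc k)) (z ℚ./ suc k) ⟩
  toℚᵘ (ι (suc k)) ℚᵘ.* toℚᵘ (z ℚ./ suc k) ≈⟨ ℚᵘ.*-cong (toℚᵘ-fromℚᵘ (ℚᵘ.mkℚᵘ (+ suc k) 0)) (toℚᵘ-fromℚᵘ (ℚᵘ.mkℚᵘ z k)) ⟩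
  ℚᵘ.mkℚᵘ (+ suc k) 0 ℚᵘ.* ℚᵘ.mkℚᵘ z k     ≈⟨ ℚᵘ.*≡* cross ⟩
  ℚᵘ.mkℚᵘ z 0                               ≈⟨ ℚᵘ.≃-sym (toℚᵘ-fromℚᵘ (ℚᵘ.mkℚᵘ z 0)) ⟩
  toℚᵘ (z ℚ./ 1)                            ∎)
  where
  open ℚᵘ.≃-Reasoning
  cross : (+ suc k ℤ.* z) ℤ.* + 1 ≡ z ℤ.* + suc (k + 0)
  cross = trans (ℤ.*-identityʳ _) (trans (ℤ.*-comm (+ suc k) z) (cong (λ n → z ℤ.* + suc n) (sym (ℕ.+-identityʳ k))))

-- Binet sequences in ℚ[√D]

step√ : ℚ → ℚ√ → ℚ√ → ℚ√
step√ k x y = ⟨ k ℚ.* re x ℚ.+ re y , k ℚ.* im x ℚ.+ im y ⟩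

binet : (D E a b : ℚ) → ℕ → ℚ√
binet D E a b t = _+√_ D (_*√_ D ⟨ a , b ⟩       (_^√_ D ⟨ E ℚ.* ½ , ½ ⟩      t))
                         (_*√_ D ⟨ a , ℚ.- b ⟩ (_^√_ D ⟨ E ℚ.* ½ , ℚ.- ½ ⟩ t))

-- ℚ[√D] arithmetic on solver syntax: evaluation turns _⊞_ and _⊠_ definitionally into
-- _+√_ and _*√_, so each component of an identity in ℚ√ becomes a ring identity over ℚ.
module √Syntax {n : ℕ} (D : Polynomial n) where

  √Poly : Set
  √Poly = Polynomial n × Polynomial n

  _⊞_ _⊠_ : √Poly → √Poly → √Poly
  (a , b) ⊞ (c , e) = a :+ c , b :+ e
  (a , b) ⊠ (c , e) = a :* c :+ D :* (b :* e) , a :* e :+ b :* c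

  binetSyntax : (a b : Polynomial n) → √Poly → √Poly → √Poly
  binetSyntax a b X Y = ((a , b) ⊠ X) ⊞ ((a , :- b) ⊠ Y)

-- (E ± √D) / 2 are the roots of x² = E x + 1 when D = E² + 4.
binet-recurrence : ∀ D E a b t → D ≡ ι 4 ℚ.+ E ℚ.* E →
                   binet D E a b (2 + t) ≡ step√ E (binet D E a b (1 + t)) (binet D E a b t)
binet-recurrence .(ι 4 ℚ.+ E ℚ.* E) E a b t refl =
  cong₂ ⟨_,_⟩ (prove ρ (proj₁ lhs) (vE :* proj₁ mid :+ proj₁ rhs) refl)
              (prove ρ (proj₂ lhs) (vE :* proj₂ mid :+ proj₂ rhs) refl)
  where
  X Y : ℚ√
  X = _^√_ (ι 4 ℚ.+ E ℚ.* E) ⟨ E ℚ.* ½ , ½ ⟩ t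
  Y = _^√_ (ι 4 ℚ.+ E ℚ.* E) ⟨ E ℚ.* ½ , ℚ.- ½ ⟩ t
  ρ : Vec ℚ 7
  ρ = E ∷ a ∷ b ∷ re X ∷ im X ∷ re Y ∷ im Y ∷ []
  vE va vb x₁ x₂ y₁ y₂ : Polynomial 7
  vE = var (# 0); va = var (# 1); vb = var (# 2)
  x₁ = var (# 3); x₂ = var (# 4); y₁ = var (# 5); y₂ = var (# 6)
  open √Syntax (con (ι 4) :+ vE :* vE)
  μ₊ μ₋ : √Poly
  μ₊ = vE :* con ½ , con ½
  μ₋ = vE :* con ½ , :- con ½
  lhs mid rhs : √Poly
  lhs = binetSyntax va vb (μ₊ ⊠ (μ₊ ⊠ (x₁ , x₂))) (μ₋ ⊠ (μ₋ ⊠ (y₁ , y₂)))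
  mid = binetSyntax va vb (μ₊ ⊠ (x₁ , x₂)) (μ₋ ⊠ (y₁ , y₂))
  rhs = binetSyntax va vb (x₁ , x₂) (y₁ , y₂)

binet-initial : ∀ D E a b → binet D E a b 0 ≡ ⟨ a ℚ.+ a , 0ℚ ⟩ × binet D E a b 1 ≡ ⟨ E ℚ.* a ℚ.+ D ℚ.* b , 0ℚ ⟩
binet-initial D E a b =
  cong₂ ⟨_,_⟩ (prove ρ (proj₁ at0) (va :+ va) refl) (prove ρ (proj₂ at0) (con 0ℚ) refl) ,
  cong₂ ⟨_,_⟩ (prove ρ (proj₁ at1) (vE :* va :+ vD :* vb) refl) (prove ρ (proj₂ at1) (con 0ℚ) refl)
  where
  ρ : Vec ℚ 4
  ρ = D ∷ E ∷ a ∷ b ∷ []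
  vD vE va vb : Polynomial 4
  vD = var (# 0); vE = var (# 1); va = var (# 2); vb = var (# 3)
  open √Syntax vD
  one : √Poly
  one = con 1ℚ , con 0ℚ
  at0 at1 : √Poly
  at0 = binetSyntax va vb one one
  at1 = binetSyntax va vb ((vE :* con ½ , con ½) ⊠ one) ((vE :* con ½ , :- con ½) ⊠ one)

recurrence-unique : {A : Set} (step : A → A → A) (f g : ℕ → A) → f 0 ≡ g 0 → f 1 ≡ g 1 →
                    (∀ t → f (2 + t) ≡ step (f (1 + t)) (f t)) →
                    (∀ t → g (2 + t) ≡ step (g (1 + t)) (g t)) → ∀ t → f t ≡ g t
recurrence-unique step f g f₀ f₁ f-step g-step t = proj₁ (consecutive t)
  where
  consecutive : ∀ t → f t ≡ g t × f (1 + t) ≡ g (1 + t)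
  consecutive zero    = f₀ , f₁
  consecutive (suc t) = let (fₜ , fₜ₊₁) = consecutive t in
    fₜ₊₁ , trans (f-step t) (trans (cong₂ step fₜ₊₁ fₜ) (sym (g-step t)))

ℕtoℚ√-step : ∀ k m n → ℕtoℚ√ (k * m + n) ≡ step√ (ι k) (ℕtoℚ√ m) (ℕtoℚ√ n)
ℕtoℚ√-step k m n = cong₂ ⟨_,_⟩
  (trans (ι-+ (k * m) n) (cong (ℚ._+ ι n) (ι-* k m)))
  (solve 1 (λ x → con 0ℚ := x :* con 0ℚ :+ con 0ℚ) refl (ι k))

-- Cayley–Hamilton for the transfer matrix [[1, e], [1, e ∸ 1]] of CK(1 + e, 4), which has
-- trace e and, for e ≥ 1, determinant −1.
transfer-square : ∀ e p q → let p′ = p * 1 + q * 1 ; q′ = p * e + q * (e ∸ 1) in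
                  (p′ * 1 + q′ * 1) + (p′ * e + q′ * (e ∸ 1)) ≡ e * (p′ + q′) + (p + q)
transfer-square zero    = ℕ-Solver.solve-∀
transfer-square (suc f) = polynomial f
  where
  polynomial : ∀ f p q → let p′ = p * 1 + q * 1 ; q′ = p * suc f + q * f in
               (p′ * 1 + q′ * 1) + (p′ * suc f + q′ * f) ≡ suc f * (p′ + q′) + (p + q)
  polynomial = ℕ-Solver.solve-∀

Aℤ-suc : ∀ e → Aℤ (suc e) ≡ + (e * suc e + 1)
Aℤ-suc e = trans (polynomial (+ e)) (cong (ℤ._+ + 1) (sym (ℤ.pos-* e (suc e))))
  where
  polynomial : ∀ x → (+ 1 ℤ.+ x) ℤ.* (+ 1 ℤ.+ x) ℤ.- (+ 1 ℤ.+ x) ℤ.+ + 1 ≡ x ℤ.* (+ 1 ℤ.+ x) ℤ.+ + 1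
  polynomial = ℤ-Solver.solve-∀

Bℤ-suc : ∀ e → Bℤ (suc e) ≡ + (e * (e * suc e + 3) + 2)
Bℤ-suc e = begin
  Bℤ (suc e)                                ≡⟨ polynomial (+ e) ⟩
  + e ℤ.* (+ e ℤ.* + suc e ℤ.+ + 3) ℤ.+ + 2 ≡⟨ cong (λ z → + e ℤ.* (z ℤ.+ + 3) ℤ.+ + 2) (sym (ℤ.pos-* e (suc e))) ⟩
  + e ℤ.* + (e * suc e + 3) ℤ.+ + 2         ≡⟨ cong (ℤ._+ + 2) (sym (ℤ.pos-* e (e * suc e + 3))) ⟩
  + (e * (e * suc e + 3) + 2)               ∎
  where
  open ≡-Reasoning
  polynomial : ∀ x → let y = + 1 ℤ.+ x in
    y ℤ.* y ℤ.* y ℤ.- + 2 ℤ.* y ℤ.* y ℤ.+ + 4 ℤ.* y ℤ.- + 1 ≡ x ℤ.* (x ℤ.* y ℤ.+ + 3) ℤ.+ + 2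
  polynomial = ℤ-Solver.solve-∀

module VertexCount (e : ℕ) where
  open CK4 (suc e) using (module Transfer)
  open Transfer using (walks; vertices-↔) public

  d : ℕ
  d = suc e

  N : ℕ → ℕ
  N t = walks t true + walks t false

  N-recurrence : ∀ t → N (2 + t) ≡ e * N (1 + t) + N t
  N-recurrence t = transfer-square e (walks t true) (walks t false)

  A′ B′ : ℕ
  A′ = e * suc e + 1
  B′ = e * (e * suc e + 3) + 2

  N₀-formula : N 0 ≡ d * suc d * A′
  N₀-formula = polynomial e
    where
    polynomial : ∀ e → suc (suc e) * (1 * (suc e * suc e)) + suc (suc e) * (suc e * (e * e))
                       ≡ suc e * suc (suc e) * (e * suc e + 1)
    polynomial = ℕ-Solver.solve-∀

  N₁-formula : 2 * N 1 ≡ d * suc d * (e * A′ + B′)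
  N₁-formula = polynomial e
    where
    polynomial : ∀ e → let d = suc e ; p = suc d * (1 * (d * d)) ; q = suc d * (d * (e * e)) in
      2 * ((p * 1 + q * 1) + (p * e + q * (e ∸ 1))) ≡ d * suc d * (e * (e * suc e + 1) + (e * (e * suc e + 3) + 2))
    polynomial zero    = refl
    polynomial (suc f) = polynomial-suc f
      where
      polynomial-suc : ∀ f → let e = suc f ; d = suc e ; p = suc d * (1 * (d * d)) ; q = suc d * (d * (e * e)) in
        2 * ((p * 1 + q * 1) + (p * e + q * f)) ≡ d * suc d * (e * (e * suc e + 1) + (e * (e * suc e + 3) + 2))
      polynomial-suc = ℕ-Solver.solve-∀

  -- u is definitionally ι (d * suc d), and closedForm d is definitionally binet (Dℚ d) (ι e) a b.
  u w r : ℚ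
  u = ℤtoℚ (+ d ℤ.* + suc d)
  w = ℤtoℚ (Aℤ d)
  r = Bℤ d ℚ./ Dℕ d

  a b : ℚ
  a = cℚ d ℚ.* w
  b = cℚ d ℚ.* r

  Dℚ-suc : Dℚ d ≡ ι 4 ℚ.+ ι e ℚ.* ι e
  Dℚ-suc = trans (ι-+ 4 (e * e)) (cong (ι 4 ℚ.+_) (ι-* e e))

  initial₀ : a ℚ.+ a ≡ ι (N 0)
  initial₀ = begin
    a ℚ.+ a                ≡⟨ solve 2 (λ u w → con ½ :* u :* w :+ con ½ :* u :* w := u :* w) refl u w ⟩
    u ℚ.* w                ≡⟨ cong (λ z → u ℚ.* ℤtoℚ z) (Aℤ-suc e) ⟩
    ι (d * suc d) ℚ.* ι A′ ≡⟨ sym (ι-* (d * suc d) A′) ⟩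
    ι (d * suc d * A′)     ≡⟨ cong ι (sym N₀-formula) ⟩
    ι (N 0)                ∎
    where open ≡-Reasoning

  initial₁ : ι e ℚ.* a ℚ.+ Dℚ d ℚ.* b ≡ ι (N 1)
  initial₁ = begin
    ι e ℚ.* a ℚ.+ Dℚ d ℚ.* b
      ≡⟨ solve 5 (λ u w r D E → E :* (con ½ :* u :* w) :+ D :* (con ½ :* u :* r)
                              := con ½ :* (u :* (E :* w :+ D :* r))) refl u w r (Dℚ d) (ι e) ⟩
    ½ ℚ.* (u ℚ.* (ι e ℚ.* w ℚ.+ Dℚ d ℚ.* r))
      ≡⟨ cong (λ z → ½ ℚ.* (u ℚ.* z)) (cong₂ (λ x y → ι e ℚ.* ℤtoℚ x ℚ.+ y) (Aℤ-suc e)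
                                           (trans (ι-*-/ (3 + e * e) (Bℤ d)) (cong ℤtoℚ (Bℤ-suc e)))) ⟩
    ½ ℚ.* (ι (d * suc d) ℚ.* (ι e ℚ.* ι A′ ℚ.+ ι B′))
      ≡⟨ cong (½ ℚ.*_) (sym (trans (ι-* (d * suc d) (e * A′ + B′)) (cong (ι (d * suc d) ℚ.*_) (trans (ι-+ (e * A′) B′) (cong (ℚ._+ ι B′) (ι-* e A′)))))) ⟩
    ½ ℚ.* ι (d * suc d * (e * A′ + B′))
      ≡⟨ cong (λ n → ½ ℚ.* ι n) (sym N₁-formula) ⟩
    ½ ℚ.* ι (2 * N 1)
      ≡⟨ cong (½ ℚ.*_) (ι-* 2 (N 1)) ⟩
    ½ ℚ.* (ι 2 ℚ.* ι (N 1))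
      ≡⟨ solve 1 (λ x → con ½ :* (con (ι 2) :* x) := x) refl (ι (N 1)) ⟩
    ι (N 1) ∎
    where open ≡-Reasoning

  closedForm≡N : ∀ t → closedForm d t ≡ ℕtoℚ√ (N t)
  closedForm≡N = recurrence-unique (step√ (ι e)) (closedForm d) (ℕtoℚ√ ∘ N)
    (trans (proj₁ (binet-initial (Dℚ d) (ι e) a b)) (cong (λ x → ⟨ x , 0ℚ ⟩) initial₀))
    (trans (proj₂ (binet-initial (Dℚ d) (ι e) a b)) (cong (λ x → ⟨ x , 0ℚ ⟩) initial₁))
    (λ t → binet-recurrence (Dℚ d) (ι e) a b t Dℚ-suc)
    (λ t → trans (cong ℕtoℚ√ (N-recurrence t)) (ℕtoℚ√-step e (N (1 + t)) (N t)))

proposition20 : (d : ℕ) → 1 ≤ d →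
    Σ (ℕ → ℕ) λ N →
    ((t : ℕ) → V (L^ t (CK d 4)) ↔ Fin (N t))
    × ((t : ℕ) → ℕtoℚ√ (N t) ≡ closedForm d t)
    × (d ≡ 2 → (N 0 ≡ 18) × (N 1 ≡ 30)
    × ((t : ℕ) → N (2 + t) ≡ N (1 + t) + N t))
proposition20 (suc e) _ = N , vertices-↔ , (λ t → sym (closedForm≡N t)) , fibonacci
  where
  open VertexCount e
  fibonacci : suc e ≡ 2 → (N 0 ≡ 18) × (N 1 ≡ 30) × (∀ t → N (2 + t) ≡ N (1 + t) + N t)
  fibonacci refl = refl , refl , λ t → trans (N-recurrence t) (cong (_+ N t) (ℕ.*-identityˡ (N (1 + t))))
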